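{- For any single-elimination tournament $\mathcal{T}$, any scoring system $\sigma$ and any bracket $\widehat{B}$ of $\mathcal{T}$, the set $\{\widehat{B}_a:a\in P(\mathcal{T})\}$ is a $\sigma$-resolving set.
   Context: For a digraph, $N^+(v)$ is the set of out-neighbours of $v$ and $N^-(v)$ the set of in-neighbours; a sink has $N^+(v)=\emptyset$, a source has $N^-(v)=\emptyset$. A single-elimination tournament $\mathcal{T}$ is a finite digraph with: exactly one sink; $|N^+(v)|=1$ for every non-sink $v$; no directed cycles; and $|N^-(v)|\ne 1$ for every vertex $v$. Players $P(\mathcal{T})$ are the sources; matches $M(\mathcal{T})$ are the non-sources. A directed walk from $u_1$ to $u_t$ is a sequence $(u_1,\dots,u_t)$, $t\ge1$, with $u_{i+1}\in N^+(u_i)$; the player set $P(u)$ of a vertex $u$ is the set of players $c$ with a directed walk from $c$ to $u$. A bracket is a function $B:V(\mathcal{T})\to P(\mathcal{T})$ with $B(c)=c$ for every player $c$ and $B(x)\in\{B(u):u\in N^-(x)\}$ for every match $x$. For a bracket $\widehat{B}$ and player $a$, $\widehat{B}_a$ is the function with $\widehat{B}_a(u)=a$ if $a\in P(u)$ and $\widehat{B}_a(u)=\widehat{B}(u)$ otherwise (it is again a bracket). A scoring system is a function $\sigma:M(\mathcal{T})\to\mathbb{R}_{>0}$; $\mathrm{score}_\sigma(B,B')=\sum_{x\in M(\mathcal{T}):B(x)=B'(x)}\sigma(x)$. A set of brackets $\mathcal{B}$ is $\sigma$-resolving if for all pairs of distinct brackets $B,B'$ there is $B_i\in\mathcal{B}$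 with $\mathrm{score}_\sigma(B_i,B)\ne\mathrm{score}_\sigma(B_i,B')$. -}

module Defs where

open import Level using (Level; _⊔_) renaming (suc to lsuc)
open import Data.Nat using (ℕ; zero; suc; _+_)
open import Data.Bool using (Bool; true; false; if_then_else_; _∧_; not)
open import Data.Fin using (Fin)
open import Data.Fin.Properties using () renaming (_≟_ to _≟ᶠ_)
open import Data.List using (List; foldr; map; allFin)
open import Data.Nat.ListAction using (sum)
open import Data.Product using (Σ; _×_; _,_)
open import Data.Empty using (⊥)
open import Relation.Nullary using (¬_; does)
open import Relation.Binary.PropositionalEquality using (_≡_)
open import Relation.Binary.Core using (Rel)
open import Relation.Binary.Structures using (IsStrictTotalOrder)
open import Algebra.Bundles using (AbelianGroup)
import Data.Nat as ℕ

Digraph : ℕ → Set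
Digraph n = Fin n → Fin n → Bool

module _ {n : ℕ} (G : Digraph n) where

  Arc : Fin n → Fin n → Set
  Arc u v = G u v ≡ true

  outdeg : Fin n → ℕ
  outdeg v = sum (map (λ u → if G v u then 1 else 0) (allFin n))

  indeg : Fin n → ℕ
  indeg v = sum (map (λ u → if G u v then 1 else 0) (allFin n))

  IsSink : Fin n → Set
  IsSink v = outdeg v ≡ 0

  IsSource : Fin n → Set
  IsSource v = indeg v ≡ 0

  data Walk : Fin n → Fin n → Set where
    here : ∀ {u} → Walk u u
    step : ∀ {u v w} → Arc u v → Walk v w → Walk u w

  HasCycle : Set
  HasCycle = Σ (Fin n) λ u → Σ (Fin n) λ v → Arc u v × Walk v u

  IsSET : Set
  IsSET =
      (Σ (Fin n) λ s → IsSink s × (∀ v → IsSink v → v ≡ s))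
    × (∀ v → ¬ IsSink v → outdeg v ≡ 1)
    × ¬ HasCycle
    × (∀ v → ¬ (indeg v ≡ 1))

  IsPlayer : Fin n → Set
  IsPlayer = IsSource

  IsMatch : Fin n → Set
  IsMatch v = ¬ IsSource v

  isMatchᵇ : Fin n → Bool
  isMatchᵇ v = not (does (indeg v ℕ.≟ 0))

  _∈P_ : Fin n → Fin n → Set
  c ∈P u = IsPlayer c × Walk c u

  IsBracket : (Fin n → Fin n) → Set
  IsBracket B =
      (∀ v → IsPlayer (B v))
    × (∀ c → IsPlayer c → B c ≡ c)
    × (∀ x → IsMatch x → Σ (Fin n) λ u → Arc u x × B x ≡ B u)

  IsModifiedBracket : (Bhat : Fin n → Fin n) (a : Fin n) (Ba : Fin n → Fin n) → Set
  IsModifiedBracket Bhat a Ba =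
    ∀ u → (a ∈P u → Ba u ≡ a) × (¬ (a ∈P u) → Ba u ≡ Bhat u)

-- Totally ordered abelian groups (the codomain of scoring systems;
-- ℝ with + and < is an instance).

record OrderedAbelianGroup (c ℓ₁ ℓ₂ : Level) : Set (lsuc (c ⊔ ℓ₁ ⊔ ℓ₂)) where
  field
    abelianGroup : AbelianGroup c ℓ₁
  open AbelianGroup abelianGroup public
  field
    _<_                : Rel Carrier ℓ₂
    isStrictTotalOrder : IsStrictTotalOrder _≈_ _<_
    ∙-monoˡ-<          : ∀ {x y} z → x < y → (x ∙ z) < (y ∙ z)

module _ {c ℓ₁ ℓ₂ : Level} (R : OrderedAbelianGroup c ℓ₁ ℓ₂) where
  open OrderedAbelianGroup R

  -- scoring system: positive weight on every match (values on players unused)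
  IsScoring : {n : ℕ} → Digraph n → (Fin n → Carrier) → Set ℓ₂
  IsScoring G σ = ∀ x → IsMatch G x → ε < σ x

  score : {n : ℕ} → Digraph n → (Fin n → Carrier) → (Fin n → Fin n) → (Fin n → Fin n) → Carrier
  score {n} G σ B B' =
    foldr (λ x acc → (if isMatchᵇ G x ∧ does (B x ≟ᶠ B' x) then σ x else ε) ∙ acc)
          ε (allFin n)

{-# OPTIONS --safe #-}
-- Let x be a vertex where B and B′ disagree while all earlier vertices agree, and put
-- a = B x, b = B′ x.  As every vertex has at most one out-arc, the walks leaving a vertex
-- are nested, and the winner of a match in a bracket has won every earlier match on its way.
-- So at each vertex u the agreements of B̂_a with B and of B̂_b with B′ weigh at least as much
-- as those of B̂_a with B′ and of B̂_b with B: if only a reaches u then u precedes x, so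
-- B u = B′ u; if both reach u then u lies after x, so B′ u ≢ a and B u ≢ b.  At u = x the
-- inequality is strict, hence score(B̂_a,B) + score(B̂_b,B′) > score(B̂_a,B′) + score(B̂_b,B),
-- and B̂_a or B̂_b separates B from B′.
module Submission where

open import Defs
open import Level using (Level)
open import Data.Nat as ℕ using (ℕ; zero; suc; _+_; s≤s)
import Data.Nat.Properties as ℕ
open import Data.Bool using (true; false; if_then_else_; _∧_; not)
import Data.Bool.Properties as Bool
open import Data.Fin as Fin using (Fin; zero; suc)
open import Data.Fin.Properties using (_≟_; any?; pigeonhole; ¬∀⟶∃¬)
open import Data.List using (List; []; _∷_; foldr; allFin; tabulate)
open import Data.List.Properties using (map-tabulate)
open import Data.List.Membership.Propositional using (_∈_)
open import Data.List.Membership.Propositional.Properties using (∈-allFin)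
open import Data.List.Relation.Unary.Any using (here; there)
open import Data.Nat.ListAction using (sum)
open import Data.Product using (Σ; ∃; _×_; _,_; proj₁; proj₂)
open import Data.Sum using (_⊎_; inj₁; inj₂; [_,_]′)
open import Function using (id; _∘_)
open import Induction.WellFounded using (Acc; acc; WellFounded)
open import Relation.Nullary using (¬_; Dec; yes; no; does; contradiction)
open import Relation.Nullary.Decidable as Dec using (_×-dec_; ¬?; dec-true; dec-false; decidable-stable)
open import Relation.Unary using (Decidable)
open import Relation.Binary.PropositionalEquality as ≡ using (_≡_; _≢_; refl; sym; cong; cong₂; subst)
open import Relation.Binary.Structures using (IsStrictTotalOrder)
open import Relation.Binary.Definitions using (DecidableEquality; tri<; tri≈; tri>)
import Relation.Binary.Construct.StrictToNonStrict as StrictToNonStrict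
import Algebra.Properties.CommutativeSemigroup as CommutativeSemigroupProperties

sum-tabulate-≥ : ∀ {m} (f : Fin m → ℕ) i → f i ℕ.≤ sum (tabulate f)
sum-tabulate-≥ f zero    = ℕ.m≤m+n _ _
sum-tabulate-≥ f (suc i) = ℕ.≤-trans (sum-tabulate-≥ (f ∘ suc) i) (ℕ.m≤n+m _ _)

sum-tabulate-≥₂ : ∀ {m} (f : Fin m → ℕ) {i j} → i ≢ j → f i + f j ℕ.≤ sum (tabulate f)
sum-tabulate-≥₂ f {zero}  {zero}  i≢j = contradiction refl i≢j
sum-tabulate-≥₂ f {zero}  {suc j} _   = ℕ.+-monoʳ-≤ (f zero) (sum-tabulate-≥ (f ∘ suc) j)
sum-tabulate-≥₂ f {suc i} {zero}  i≢j rewrite ℕ.+-comm (f (suc i)) (f zero) =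
  sum-tabulate-≥₂ f (i≢j ∘ sym)
sum-tabulate-≥₂ f {suc i} {suc j} i≢j =
  ℕ.≤-trans (sum-tabulate-≥₂ (f ∘ suc) (i≢j ∘ cong suc)) (ℕ.m≤n+m _ _)

Functional : ∀ {n} → Digraph n → Set
Functional G = ∀ {v y z} → Arc G v y → Arc G v z → y ≡ z

module _ {n : ℕ} (G : Digraph n) where

  private
    indicator : Fin n → Fin n → ℕ
    indicator u v = if G u v then 1 else 0

    indicator-arc : ∀ {u v} → Arc G u v → indicator u v ≡ 1
    indicator-arc u→v rewrite u→v = refl

  outdeg-≥₂ : ∀ {v y z} → Arc G v y → Arc G v z → y ≢ z → 2 ℕ.≤ outdeg G v
  outdeg-≥₂ {v} {y} {z} v→y v→z y≢z = begin
    2                                      ≡⟨ cong₂ _+_ (indicator-arc v→y) (indicator-arc v→z) ⟨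
    indicator v y + indicator v z          ≤⟨ sum-tabulate-≥₂ (indicator v) y≢z ⟩
    sum (tabulate (indicator v))           ≡⟨ cong sum (map-tabulate id (indicator v)) ⟨
    outdeg G v                             ∎
    where open ℕ.≤-Reasoning

  arc-target-isMatch : ∀ {u v} → Arc G u v → IsMatch G v
  arc-target-isMatch {u} {v} u→v source = ℕ.<⇒≢ (begin-strict
    0                                      <⟨ ℕ.z<s ⟩
    1                                      ≡⟨ indicator-arc u→v ⟨
    indicator u v                          ≤⟨ sum-tabulate-≥ (λ w → indicator w v) u ⟩
    sum (tabulate (λ w → indicator w v))   ≡⟨ cong sum (map-tabulate id (λ w → indicator w v)) ⟨
    indeg G v                              ∎) (sym source)
    where open ℕ.≤-Reasoning

  IsSET⇒Functional : IsSET G → Functional G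
  IsSET⇒Functional (_ , outdeg≡1 , _) {v} {y} {z} v→y v→z =
    decidable-stable (y ≟ z) λ y≢z →
      let 2≤outdeg = outdeg-≥₂ v→y v→z y≢z
          nonSink  = λ sink → contradiction (subst (2 ℕ.≤_) sink 2≤outdeg) λ ()
      in contradiction (subst (2 ℕ.≤_) (outdeg≡1 v nonSink) 2≤outdeg) λ { (s≤s ()) }

  isMatchᵇ⇒IsMatch : ∀ {u} → isMatchᵇ G u ≡ true → IsMatch G u
  isMatchᵇ⇒IsMatch {u} isMatch source
    with () ← subst (λ d → not d ≡ true) (dec-true (indeg G u ℕ.≟ 0) source) isMatch

  IsMatch⇒isMatchᵇ : ∀ {u} → IsMatch G u → isMatchᵇ G u ≡ true
  IsMatch⇒isMatchᵇ {u} match = cong not (dec-false (indeg G u ℕ.≟ 0) match)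

module Walks {n : ℕ} (G : Digraph n) where

  private variable
    c d u v w x y : Fin n

  -- HasCycle G is definitionally ∃ λ u → Walk⁺ u u.
  Walk⁺ : Fin n → Fin n → Set
  Walk⁺ u v = ∃ λ w → Arc G u w × Walk G w v

  length : Walk G u v → ℕ
  length here       = 0
  length (step _ p) = suc (length p)

  infixr 5 _◅◅_
  infixl 5 _▻_

  _◅◅_ : Walk G u v → Walk G v w → Walk G u w
  here     ◅◅ q = q
  step a p ◅◅ q = step a (p ◅◅ q)

  _▻_ : Walk G u v → Arc G v w → Walk G u w
  p ▻ a = p ◅◅ step a here

  length-◅◅-step : (p : Walk G u v) (a : Arc G v w) (q : Walk G w x) →
                   length p ℕ.< length (p ◅◅ step a q)
  length-◅◅-step here       a q = ℕ.z<s
  length-◅◅-step (step b p) a q = s≤s (length-◅◅-step p a q)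

  unsnoc : Walk G u v → u ≡ v ⊎ ∃ λ w → Walk G u w × Arc G w v
  unsnoc here = inj₁ refl
  unsnoc (step a p) with unsnoc p
  ... | inj₁ refl          = inj₂ (_ , here , a)
  ... | inj₂ (w , q , b)   = inj₂ (w , step a q , b)

  vertex : (p : Walk G u v) → Fin (suc (length p)) → Fin n
  vertex {u} p          zero    = u
  vertex     (step _ p) (suc i) = vertex p i

  prefix : (p : Walk G u v) (i : Fin (suc (length p))) → Walk G u (vertex p i)
  prefix p          zero    = here
  prefix (step a p) (suc i) = step a (prefix p i)

  segment : (p : Walk G u v) {i j : Fin (suc (length p))} → i Fin.< j →
            Walk⁺ (vertex p i) (vertex p j)
  segment (step a p) {zero}  {suc j} _         = _ , a , prefix p j
  segment (step a p) {suc i} {suc j} (s≤s i<j) = segment p i<j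

  arc? : ∀ u v → Dec (Arc G u v)
  arc? u v = G u v Bool.≟ true

  module Acyclic (acyclic : ¬ HasCycle G) where

    length<n : (p : Walk G u v) → length p ℕ.< n
    length<n p with length p ℕ.<? n
    ... | yes p<n = p<n
    ... | no  p≮n with i , j , i<j , same ← pigeonhole (s≤s (ℕ.≮⇒≥ p≮n)) (vertex p) =
      contradiction (_ , subst (λ t → Walk⁺ t (vertex p j)) same (segment p i<j)) acyclic

    Walk⁺-wellFounded : WellFounded Walk⁺
    Walk⁺-wellFounded v = bounded⇒acc n v length<n
      where
      bounded⇒acc : ∀ k v → (∀ {u} (p : Walk G u v) → length p ℕ.< k) → Acc Walk⁺ v
      bounded⇒acc zero    v bound with () ← bound here
      bounded⇒acc (suc k) v bound = acc λ (_ , a , q) → bounded⇒acc k _ λ p →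
        ℕ.<-≤-trans (length-◅◅-step p a q) (ℕ.≤-pred (bound (p ◅◅ step a q)))

    walk? : ∀ u v → Dec (Walk G u v)
    walk? u v = search v (Walk⁺-wellFounded v)
      where
      search : ∀ v → Acc Walk⁺ v → Dec (Walk G u v)
      search v (acc rec) with u ≟ v
      ... | yes refl = yes here
      ... | no  u≢v  = Dec.map′ (λ (_ , p , a) → p ▻ a)
                                ([ (λ u≡v → contradiction u≡v u≢v) , id ]′ ∘ unsnoc)
                                (any? last-arc?)
        where
        last-arc? : ∀ w → Dec (Walk G u w × Arc G w v)
        last-arc? w with arc? w v
        ... | yes a = Dec.map′ (_, a) proj₁ (search w (rec (_ , a , here)))
        ... | no ¬a = no (¬a ∘ proj₂)

    walk⁺? : ∀ u v → Dec (Walk⁺ u v)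
    walk⁺? u v = any? λ w → arc? u w ×-dec walk? w v

    Walk⁺-minimal : (P : Fin n → Set) → Decidable P → P v →
                    ∃ λ x → P x × (∀ {u} → Walk⁺ u x → ¬ P u)
    Walk⁺-minimal {v} P P? = descend v (Walk⁺-wellFounded v)
      where
      descend : ∀ v → Acc Walk⁺ v → P v → ∃ λ x → P x × (∀ {u} → Walk⁺ u x → ¬ P u)
      descend v (acc rec) pv with any? (λ u → walk⁺? u v ×-dec P? u)
      ... | yes (u , u⊏v , pu) = descend u (rec u⊏v) pu
      ... | no  none           = v , pv , λ u⊏v pu → none (_ , u⊏v , pu)

    minimal-disagreement : ∀ {A : Set} → DecidableEquality A → {f g : Fin n → A} →
                           ¬ (∀ v → f v ≡ g v) →
                           ∃ λ x → f x ≢ g x × (∀ {u} → Walk⁺ u x → f u ≡ g u)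
    minimal-disagreement _≟ᴬ_ {f} {g} f≢g
      with _ , fv≢gv ← ¬∀⟶∃¬ n _ (λ v → f v ≟ᴬ g v) f≢g
      with x , fx≢gx , minimal ← Walk⁺-minimal _ (λ u → ¬? (f u ≟ᴬ g u)) fv≢gv
      = x , fx≢gx , decidable-stable (_ ≟ᴬ _) ∘ minimal

  module FunctionalWalks (functional : Functional G) where

    comparable : Walk G c x → Walk G c y → Walk G x y ⊎ Walk G y x
    comparable here         q            = inj₁ q
    comparable (step a p)   here         = inj₂ (step a p)
    comparable (step a p)   (step b q) with functional a b
    ... | refl = comparable p q

    strictly-before : Walk G c x → Walk G d x → Walk G c u → ¬ Walk G d u → Walk⁺ u x
    strictly-before c⇝x d⇝x c⇝u ¬d⇝u with comparable c⇝x c⇝u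
    ... | inj₁ x⇝u             = contradiction (d⇝x ◅◅ x⇝u) ¬d⇝u
    ... | inj₂ here            = contradiction d⇝x ¬d⇝u
    ... | inj₂ (step u→w w⇝x) = _ , u→w , w⇝x

    in-neighbours-≡ : ¬ HasCycle G → Walk G c x → Walk G c w → Arc G x y → Arc G w y → x ≡ w
    in-neighbours-≡ acyclic c⇝x c⇝w x→y w→y with comparable c⇝x c⇝w
    ... | inj₁ here = refl
    ... | inj₂ here = refl
    ... | inj₁ (step x→x′ x′⇝w) with refl ← functional x→y x→x′ =
      contradiction (_ , _ , w→y , x′⇝w) acyclic
    ... | inj₂ (step w→w′ w′⇝x) with refl ← functional w→y w→w′ =
      contradiction (_ , _ , x→y , w′⇝x) acyclic

module Bracket {n : ℕ} {G : Digraph n} (acyclic : ¬ HasCycle G) (functional : Functional G)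
               {B : Fin n → Fin n} (isBracket : IsBracket G B) where
  open Walks G
  open Acyclic acyclic
  open FunctionalWalks functional

  B-fixes-players : ∀ c → IsPlayer G c → B c ≡ c
  B-fixes-players = proj₁ (proj₂ isBracket)

  B-from-in-neighbour : ∀ x → IsMatch G x → ∃ λ u → Arc G u x × B x ≡ B u
  B-from-in-neighbour = proj₂ (proj₂ isBracket)

  winner-reaches : ∀ v → Walk G (B v) v
  winner-reaches v = go v (Walk⁺-wellFounded v)
    where
    go : ∀ v → Acc Walk⁺ v → Walk G (B v) v
    go v (acc rec) with indeg G v ℕ.≟ 0
    ... | yes player = subst (λ c → Walk G c v) (≡.sym (B-fixes-players v player)) here
    ... | no  match with u , u→v , Bv≡Bu ← B-from-in-neighbour v match =
      subst (λ c → Walk G c v) (≡.sym Bv≡Bu) (go u (rec (_ , u→v , here)) ▻ u→v)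

  wins-earlier : ∀ {c x u} → Walk G c x → Walk G x u → B u ≡ c → B x ≡ c
  wins-earlier c⇝x here Bu≡c = Bu≡c
  wins-earlier {c} {x} c⇝x (step x→y y⇝u) Bu≡c
    with w , w→y , By≡Bw ← B-from-in-neighbour _ (arc-target-isMatch G x→y) =
      subst (λ t → B t ≡ c) (≡.sym x≡w) Bw≡c
    where
    Bw≡c : B w ≡ c
    Bw≡c = ≡.trans (≡.sym By≡Bw) (wins-earlier (c⇝x ▻ x→y) y⇝u Bu≡c)
    x≡w : x ≡ w
    x≡w = in-neighbours-≡ acyclic c⇝x (subst (λ t → Walk G t w) Bw≡c (winner-reaches w)) x→y w→y

module OrderedSums {c ℓ₁ ℓ₂ : Level} (R : OrderedAbelianGroup c ℓ₁ ℓ₂) where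
  open OrderedAbelianGroup R renaming (refl to ≈-refl; sym to ≈-sym; trans to ≈-trans)
  open IsStrictTotalOrder isStrictTotalOrder
    using (<-respˡ-≈; <-respʳ-≈) renaming (trans to <-trans)
  open StrictToNonStrict _≈_ _<_ public using (_≤_)
  open CommutativeSemigroupProperties commutativeSemigroup using (interchange)

  private
    <-≤-trans : ∀ {x y z} → x < y → y ≤ z → x < z
    <-≤-trans = StrictToNonStrict.<-≤-trans _≈_ _<_ <-trans <-respʳ-≈

    ≤-<-trans : ∀ {x y z} → x ≤ y → y < z → x < z
    ≤-<-trans = StrictToNonStrict.≤-<-trans _≈_ _<_ ≈-sym <-trans <-respˡ-≈

  ∙-monoʳ-< : ∀ z {x y} → x < y → (z ∙ x) < (z ∙ y)
  ∙-monoʳ-< z x<y = <-respʳ-≈ (comm _ _) (<-respˡ-≈ (comm _ _) (∙-monoˡ-< z x<y))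

  ∙-monoˡ-≤ : ∀ z {x y} → x ≤ y → (x ∙ z) ≤ (y ∙ z)
  ∙-monoˡ-≤ z (inj₁ x<y) = inj₁ (∙-monoˡ-< z x<y)
  ∙-monoˡ-≤ z (inj₂ x≈y) = inj₂ (∙-congʳ x≈y)

  ∙-monoʳ-≤ : ∀ z {x y} → x ≤ y → (z ∙ x) ≤ (z ∙ y)
  ∙-monoʳ-≤ z (inj₁ x<y) = inj₁ (∙-monoʳ-< z x<y)
  ∙-monoʳ-≤ z (inj₂ x≈y) = inj₂ (∙-congˡ x≈y)

  ∙-mono-<-≤ : ∀ {w x y z} → w < x → y ≤ z → (w ∙ y) < (x ∙ z)
  ∙-mono-<-≤ {x = x} {y} w<x y≤z = <-≤-trans (∙-monoˡ-< y w<x) (∙-monoʳ-≤ x y≤z)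

  ∙-mono-≤-< : ∀ {w x y z} → w ≤ x → y < z → (w ∙ y) < (x ∙ z)
  ∙-mono-≤-< {x = x} {y} w≤x y<z = ≤-<-trans (∙-monoˡ-≤ y w≤x) (∙-monoʳ-< x y<z)

  ∙-mono-≤ : ∀ {w x y z} → w ≤ x → y ≤ z → (w ∙ y) ≤ (x ∙ z)
  ∙-mono-≤ (inj₁ w<x) y≤z        = inj₁ (∙-mono-<-≤ w<x y≤z)
  ∙-mono-≤ (inj₂ w≈x) (inj₁ y<z) = inj₁ (∙-mono-≤-< (inj₂ w≈x) y<z)
  ∙-mono-≤ (inj₂ w≈x) (inj₂ y≈z) = inj₂ (∙-cong w≈x y≈z)

  ∑ : ∀ {A : Set} → List A → (A → Carrier) → Carrier
  ∑ xs f = foldr (λ x acc → f x ∙ acc) ε xs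

  ∑-mono-≤ : ∀ {A : Set} {f g : A → Carrier} → (∀ x → f x ≤ g x) → ∀ xs → ∑ xs f ≤ ∑ xs g
  ∑-mono-≤ f≤g []       = inj₂ ≈-refl
  ∑-mono-≤ f≤g (x ∷ xs) = ∙-mono-≤ (f≤g x) (∑-mono-≤ f≤g xs)

  ∑-mono-< : ∀ {A : Set} {f g : A → Carrier} → (∀ x → f x ≤ g x) →
             ∀ {x xs} → x ∈ xs → f x < g x → ∑ xs f < ∑ xs g
  ∑-mono-< f≤g {xs = _ ∷ xs} (here refl) fx<gx = ∙-mono-<-≤ fx<gx (∑-mono-≤ f≤g xs)
  ∑-mono-< f≤g {xs = y ∷ _} (there x∈xs) fx<gx = ∙-mono-≤-< (f≤g y) (∑-mono-< f≤g x∈xs fx<gx)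

  ∑-∙ : ∀ {A : Set} (xs : List A) (f g : A → Carrier) → ∑ xs (λ x → f x ∙ g x) ≈ (∑ xs f ∙ ∑ xs g)
  ∑-∙ []       f g = ≈-sym (identityˡ ε)
  ∑-∙ (x ∷ xs) f g = ≈-trans (∙-congˡ (∑-∙ xs f g)) (interchange _ _ _ _)

module Agreement {c ℓ₁ ℓ₂ : Level} (R : OrderedAbelianGroup c ℓ₁ ℓ₂)
                 {n : ℕ} (G : Digraph n) (σ : Fin n → OrderedAbelianGroup.Carrier R) where
  open OrderedAbelianGroup R using (Carrier; ε) renaming (refl to ≈-refl)
  open OrderedSums R using (_≤_)

  agreement : Fin n → Fin n → Fin n → Carrier
  agreement u p q = if isMatchᵇ G u ∧ does (p ≟ q) then σ u else ε

  agreement-≢ : ∀ u {p q} → p ≢ q → agreement u p q ≡ ε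
  agreement-≢ u {p} {q} p≢q rewrite dec-false (p ≟ q) p≢q | Bool.∧-zeroʳ (isMatchᵇ G u) = ≡.refl

  agreement-match : ∀ {u} p → IsMatch G u → agreement u p p ≡ σ u
  agreement-match {u} p match rewrite dec-true (p ≟ p) ≡.refl | IsMatch⇒isMatchᵇ G match = ≡.refl

  agreement-nonneg : IsScoring R G σ → ∀ u p q → ε ≤ agreement u p q
  agreement-nonneg positive u p q with isMatchᵇ G u in isMatch | does (p ≟ q)
  ... | false | _     = inj₂ ≈-refl
  ... | true  | false = inj₂ ≈-refl
  ... | true  | true  = inj₁ (positive u (isMatchᵇ⇒IsMatch G isMatch))

module Modified {n : ℕ} {G : Digraph n} (acyclic : ¬ HasCycle G) (Bhat : Fin n → Fin n) where
  open Walks G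
  open Acyclic acyclic

  modified : Fin n → Fin n → Fin n
  modified a u with walk? a u
  ... | yes _ = a
  ... | no  _ = Bhat u

  modified-reached : ∀ {a u} → Walk G a u → modified a u ≡ a
  modified-reached {a} {u} a⇝u with walk? a u
  ... | yes _    = ≡.refl
  ... | no  ¬a⇝u = contradiction a⇝u ¬a⇝u

  modified-unreached : ∀ {a u} → ¬ Walk G a u → modified a u ≡ Bhat u
  modified-unreached {a} {u} ¬a⇝u with walk? a u
  ... | yes a⇝u = contradiction a⇝u ¬a⇝u
  ... | no  _   = ≡.refl

  modified-isModified : ∀ {a} → IsPlayer G a → IsModifiedBracket G Bhat a (modified a)
  modified-isModified player u =
    (λ (_ , a⇝u) → modified-reached a⇝u) , λ a∉P → modified-unreached λ a⇝u → a∉P (player , a⇝u)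

module Separation {c ℓ₁ ℓ₂ : Level} (R : OrderedAbelianGroup c ℓ₁ ℓ₂)
    {n : ℕ} {G : Digraph n} (acyclic : ¬ HasCycle G) (functional : Functional G)
    {σ : Fin n → OrderedAbelianGroup.Carrier R} (positive : IsScoring R G σ)
    (Bhat : Fin n → Fin n)
    {B B′ : Fin n → Fin n} (isB : IsBracket G B) (isB′ : IsBracket G B′)
    {x : Fin n} (Bx≢B′x : B x ≢ B′ x) (agree : ∀ {u} → Walks.Walk⁺ G u x → B u ≡ B′ u) where

  open OrderedAbelianGroup R
    using (Carrier; _≈_; _∙_; _<_; ε; ∙-cong; comm; isStrictTotalOrder)
    renaming (refl to ≈-refl; sym to ≈-sym)
  open IsStrictTotalOrder isStrictTotalOrder using (compare; irrefl; <-respˡ-≈; <-respʳ-≈)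
  open OrderedSums R
  open Agreement R G σ
  open Walks G
  open Acyclic acyclic using (walk?)
  open FunctionalWalks functional
  open Modified acyclic Bhat
  private
    module B  = Bracket acyclic functional isB
    module B′ = Bracket acyclic functional isB′

  a b : Fin n
  a = B x
  b = B′ x

  a⇝x : Walk G a x
  a⇝x = B.winner-reaches x

  b⇝x : Walk G b x
  b⇝x = B′.winner-reaches x

  x-isMatch : IsMatch G x
  x-isMatch source =
    Bx≢B′x (≡.trans (B.B-fixes-players x source) (≡.sym (B′.B-fixes-players x source)))

  reached-by-both⇒after-x : ∀ {u} → Walk G a u → Walk G b u → Walk G x u
  reached-by-both⇒after-x {u} a⇝u b⇝u with comparable a⇝x a⇝u
  ... | inj₁ x⇝u  = x⇝u
  ... | inj₂ here = here
  ... | inj₂ (step u→w w⇝x) = contradiction a≡b Bx≢B′x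
    where
    a≡b : a ≡ b
    a≡b = begin
      a     ≡⟨ B.wins-earlier a⇝u (step u→w w⇝x) ≡.refl ⟨
      B u   ≡⟨ agree (_ , u→w , w⇝x) ⟩
      B′ u  ≡⟨ B′.wins-earlier b⇝u (step u→w w⇝x) ≡.refl ⟩
      b     ∎
      where open ≡.≡-Reasoning

  reached-by-both⇒crossed-disagree : ∀ {u} → Walk G a u → Walk G b u → a ≢ B′ u × b ≢ B u
  reached-by-both⇒crossed-disagree a⇝u b⇝u =
      (λ a≡B′u → Bx≢B′x (≡.sym (B′.wins-earlier a⇝x x⇝u (≡.sym a≡B′u))))
    , (λ b≡Bu → Bx≢B′x (B.wins-earlier b⇝x x⇝u (≡.sym b≡Bu)))
    where
    x⇝u : Walk G x _
    x⇝u = reached-by-both⇒after-x a⇝u b⇝u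

  direct crossed : Fin n → Carrier
  direct  u = agreement u (modified a u) (B u)  ∙ agreement u (modified b u) (B′ u)
  crossed u = agreement u (modified a u) (B′ u) ∙ agreement u (modified b u) (B u)

  -- Matching on walk? a u and walk? b u also reduces modified a u and modified b u.
  crossed≤direct : ∀ u → crossed u ≤ direct u
  crossed≤direct u with walk? a u | walk? b u
  ... | yes a⇝u | yes b⇝u
    rewrite agreement-≢ u (proj₁ (reached-by-both⇒crossed-disagree a⇝u b⇝u))
          | agreement-≢ u (proj₂ (reached-by-both⇒crossed-disagree a⇝u b⇝u))
    = ∙-mono-≤ (agreement-nonneg positive u a (B u)) (agreement-nonneg positive u b (B′ u))
  ... | yes a⇝u | no ¬b⇝u rewrite agree (strictly-before a⇝x b⇝x a⇝u ¬b⇝u) = inj₂ ≈-refl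
  ... | no ¬a⇝u | yes b⇝u rewrite agree (strictly-before b⇝x a⇝x b⇝u ¬a⇝u) = inj₂ ≈-refl
  ... | no _    | no _    = inj₂ (comm _ _)

  crossed<direct-at-x : crossed x < direct x
  crossed<direct-at-x
    rewrite modified-reached a⇝x | modified-reached b⇝x
          | agreement-≢ x Bx≢B′x | agreement-≢ x (Bx≢B′x ∘ ≡.sym)
          | agreement-match a x-isMatch | agreement-match b x-isMatch
    = ∙-mono-<-≤ (positive x x-isMatch) (inj₁ (positive x x-isMatch))

  scoreᵃ scoreᵇ : (Fin n → Fin n) → Carrier
  scoreᵃ = score R G σ (modified a)
  scoreᵇ = score R G σ (modified b)

  -- score R G σ C D is definitionally ∑ (allFin n) λ u → agreement u (C u) (D u).
  crossed-scores<direct-scores : (scoreᵃ B′ ∙ scoreᵇ B) < (scoreᵃ B ∙ scoreᵇ B′)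
  crossed-scores<direct-scores =
    <-respʳ-≈ (∑-∙ (allFin n) _ _) (<-respˡ-≈ (∑-∙ (allFin n) _ _)
      (∑-mono-< crossed≤direct (∈-allFin x) crossed<direct-at-x))

  separating-player : ∃ λ c → IsPlayer G c ×
                        ¬ (score R G σ (modified c) B ≈ score R G σ (modified c) B′)
  separating-player with compare (scoreᵃ B) (scoreᵃ B′)
  ... | tri< _ ≉ _ = a , proj₁ isB x , ≉
  ... | tri> _ ≉ _ = a , proj₁ isB x , ≉
  ... | tri≈ _ ≈ᵃ _ = b , proj₁ isB′ x , λ ≈ᵇ →
    irrefl ≈-refl (<-respˡ-≈ (∙-cong (≈-sym ≈ᵃ) ≈ᵇ) crossed-scores<direct-scores)

open Walks.Acyclic using (minimal-disagreement)
open Modified using (modified; modified-isModified)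
open Separation using (separating-player)

corollary5p14 : {c ℓ₁ ℓ₂ : Level} (R : OrderedAbelianGroup c ℓ₁ ℓ₂) →
    {n : ℕ} (G : Digraph n) → IsSET G →
    (σ : Fin n → OrderedAbelianGroup.Carrier R) → IsScoring R G σ →
    (Bhat : Fin n → Fin n) → IsBracket G Bhat →
    (B B′ : Fin n → Fin n) → IsBracket G B → IsBracket G B′ → ¬ (∀ v → B v ≡ B′ v) →
    Σ (Fin n) λ a → IsPlayer G a × Σ (Fin n → Fin n) λ Ba →
      IsModifiedBracket G Bhat a Ba ×
      ¬ (OrderedAbelianGroup._≈_ R (score R G σ Ba B) (score R G σ Ba B′))
-- B̂ need not be a bracket: IsModifiedBracket only specifies B̂_a pointwise.
corollary5p14 R G set@(_ , _ , acyclic , _) σ positive Bhat _ B B′ isB isB′ B≢B′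
  with x , Bx≢B′x , agree ← minimal-disagreement G acyclic _≟_ B≢B′
  with a , player , separates ←
         separating-player R acyclic (IsSET⇒Functional G set) positive Bhat isB isB′ Bx≢B′x agree
  = a , player , modified acyclic Bhat a , modified-isModified acyclic Bhat player , separates
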